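{- In QHC, Jankov's principle $\cdot\,\neg\alpha\lor\neg\neg\alpha$ implies the ED-principle $\cdot\,\neg(\alpha\land\beta)\to\big(\nabla(\alpha\lor\beta)\to\nabla\alpha\lor\nabla\beta\big)$, where $\nabla\Phi:=\,!?\Phi$. That is, the ED-principle is derivable in QHC from Jankov's principle.
   Context: Meta-logical framework. Formulas of a first-order language may contain individual variables and predicate variables. Meta-formulas are built from formulas using meta-conjunction $\&$, meta-implication $\Rightarrow$, and universal meta-quantifiers over individual and predicate variables. A principle $\cdot G$, for a formula $G$, is the meta-formula obtained by universally meta-quantifying all free individual variables of $G$ and then all predicate variables of $G$. A rule $F_1,\dots,F_m/G$ is the meta-formula $\forall^2(\forall^1F_1\,\&\cdots\&\,\forall^1F_m\Rightarrow\forall^1G)$, where $\forall^1$ meta-quantifies the free individual variables of the formula it precedes and $\forall^2$ meta-quantifies all predicate variables occurring. A logic $L$ is given by a derivation system $\mathcal D$, a meta-conjunction of finitely many principles and rules. For a meta-formula $\mathcal F$, $\vdash_L\mathcal F$ means that $\mathcal D\Rightarrow\mathcal F$ is derivable by the natural-deduction meta-rules: introduction and elimination of $\&$, $\Rightarrow$ and the universal meta-quantifiers (elimination allows substituting terms for individual variables and formulas for predicate variables), plus $\alpha$-conversion. A principle $P$ implies $Q$ if $\vdash_L P\Rightarrow Q$. Language of QHC. It has individual variables and, for each $n\ge0$, countably many $n$-ary problem variables $\alpha,\beta,\gamma,\delta,\theta,\dots$ and countably many $n$-ary proper predicate variables $p,q,\dots$. - A c-formula is $\top$, $\bot$, an atom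 $p(x_1,\dots,x_n)$, or $?\Phi$ for an i-formula $\Phi$, closed under the classical connectives $\land,\lor,\to,\leftrightarrow,\neg$ and quantifiers $\exists,\forall$. - An i-formula is $\checkmark$ (triviality), $\curlywedge$ (absurdity), an atom $\alpha(x_1,\dots,x_n)$, or $!F$ for a c-formula $F$, closed under the intuitionistic connectives $\land,\lor,\to,\leftrightarrow,\neg$ (with $\neg\Phi:=\Phi\to\curlywedge$) and quantifiers $\exists,\forall$. Connectives applied to c-formulas are classical; those applied to i-formulas are intuitionistic. QHC is the logic whose derivation system consists of: - (0a) all laws and rules of classical predicate logic QC, for c-formulas; - (0b) all laws and rules of intuitionistic predicate logic QH, for i-formulas; - the principles $\cdot\,?(\gamma\land\delta)\leftrightarrow ?\gamma\land ?\delta$, $\cdot\,?(\gamma\lor\delta)\leftrightarrow ?\gamma\lor ?\delta$, $\cdot\,?(\gamma\to\delta)\to(?\gamma\to ?\delta)$, $\cdot\,\neg ?\curlywedge$, $\cdot\,?\exists x\,\theta(x)\leftrightarrow\exists x\,?\theta(x)$, $\cdot\,?\forall x\,\theta(x)\to\forall x\,?\theta(x)$, $\cdot\,\gamma\to\,!?\gamma$, $\cdot\,\neg !\bot$, $\cdot\,?!p\to p$, $\cdot\,!p\to\,!?!p$ and $\cdot\,!(p\to q)\to(!p\to !q)$; - the rules $!p/p$ and $p/!p$. -}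

module Defs where

open import Data.Nat using (ℕ; zero; suc)
open import Data.Vec using (Vec; map)
open import Data.Product using (Σ-syntax)
open import Relation.Binary.PropositionalEquality using (_≡_)

-- Individual variables are de Bruijn indices (ℕ);
-- the language has no function symbols, so terms are variables.
-- Predicate variables: `patm n k xs` is the k-th n-ary proper predicate
-- variable applied to xs; `aatm n k xs` the k-th n-ary problem variable.
-- `¿ Φ` renders ?Φ and `! F` renders !F.

infixr 6 _∧ᶜ_ _∧ⁱ_
infixr 5 _∨ᶜ_ _∨ⁱ_
infixr 4 _⇒ᶜ_ _⇒ⁱ_
infix 3 _⇔ᶜ_ _⇔ⁱ_
infix 9 ¿_ !_
infix 8 ¬ᶜ_ ¬ⁱ_

mutual
  data CForm : Set where
    ⊤ᶜ ⊥ᶜ : CForm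
    patm : (n k : ℕ) → Vec ℕ n → CForm
    ¿_ : IForm → CForm
    _∧ᶜ_ _∨ᶜ_ _⇒ᶜ_ : CForm → CForm → CForm
    ∀ᶜ ∃ᶜ : CForm → CForm          -- binds de Bruijn index 0

  data IForm : Set where
    ✓ ⋏ : IForm
    aatm : (n k : ℕ) → Vec ℕ n → IForm
    !_ : CForm → IForm
    _∧ⁱ_ _∨ⁱ_ _⇒ⁱ_ : IForm → IForm → IForm
    ∀ⁱ ∃ⁱ : IForm → IForm

¬ᶜ_ : CForm → CForm
¬ᶜ A = A ⇒ᶜ ⊥ᶜ

_⇔ᶜ_ : CForm → CForm → CForm
A ⇔ᶜ B = (A ⇒ᶜ B) ∧ᶜ (B ⇒ᶜ A)

¬ⁱ_ : IForm → IForm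
¬ⁱ A = A ⇒ⁱ ⋏

_⇔ⁱ_ : IForm → IForm → IForm
A ⇔ⁱ B = (A ⇒ⁱ B) ∧ⁱ (B ⇒ⁱ A)

∇ : IForm → IForm
∇ Φ = ! (¿ Φ)

lift : (ℕ → ℕ) → ℕ → ℕ
lift ρ zero = zero
lift ρ (suc i) = suc (ρ i)

mutual
  renC : (ℕ → ℕ) → CForm → CForm
  renC ρ ⊤ᶜ = ⊤ᶜ
  renC ρ ⊥ᶜ = ⊥ᶜ
  renC ρ (patm n k xs) = patm n k (map ρ xs)
  renC ρ (¿ Φ) = ¿ (renI ρ Φ)
  renC ρ (A ∧ᶜ B) = renC ρ A ∧ᶜ renC ρ B
  renC ρ (A ∨ᶜ B) = renC ρ A ∨ᶜ renC ρ B
  renC ρ (A ⇒ᶜ B) = renC ρ A ⇒ᶜ renC ρ B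
  renC ρ (∀ᶜ A) = ∀ᶜ (renC (lift ρ) A)
  renC ρ (∃ᶜ A) = ∃ᶜ (renC (lift ρ) A)

  renI : (ℕ → ℕ) → IForm → IForm
  renI ρ ✓ = ✓
  renI ρ ⋏ = ⋏
  renI ρ (aatm n k xs) = aatm n k (map ρ xs)
  renI ρ (! A) = ! (renC ρ A)
  renI ρ (A ∧ⁱ B) = renI ρ A ∧ⁱ renI ρ B
  renI ρ (A ∨ⁱ B) = renI ρ A ∨ⁱ renI ρ B
  renI ρ (A ⇒ⁱ B) = renI ρ A ⇒ⁱ renI ρ B
  renI ρ (∀ⁱ A) = ∀ⁱ (renI (lift ρ) A)
  renI ρ (∃ⁱ A) = ∃ⁱ (renI (lift ρ) A)

inst : ℕ → ℕ → ℕ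
inst y zero = y
inst y (suc i) = i

wkC : CForm → CForm
wkC = renC suc

wkI : IForm → IForm
wkI = renI suc

-- Derivability in QHC extended by additional i-formula axioms J
-- (all instances of an added principle).

mutual
  data _⊢ᶜ_ (J : IForm → Set) : CForm → Set where
    K   : ∀ {A B} → J ⊢ᶜ (A ⇒ᶜ B ⇒ᶜ A)
    S   : ∀ {A B C} → J ⊢ᶜ ((A ⇒ᶜ B ⇒ᶜ C) ⇒ᶜ (A ⇒ᶜ B) ⇒ᶜ A ⇒ᶜ C)
    ∧I  : ∀ {A B} → J ⊢ᶜ (A ⇒ᶜ B ⇒ᶜ A ∧ᶜ B)
    ∧E₁ : ∀ {A B} → J ⊢ᶜ (A ∧ᶜ B ⇒ᶜ A)
    ∧E₂ : ∀ {A B} → J ⊢ᶜ (A ∧ᶜ B ⇒ᶜ B)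
    ∨I₁ : ∀ {A B} → J ⊢ᶜ (A ⇒ᶜ A ∨ᶜ B)
    ∨I₂ : ∀ {A B} → J ⊢ᶜ (B ⇒ᶜ A ∨ᶜ B)
    ∨E  : ∀ {A B C} → J ⊢ᶜ ((A ⇒ᶜ C) ⇒ᶜ (B ⇒ᶜ C) ⇒ᶜ A ∨ᶜ B ⇒ᶜ C)
    ⊥E  : ∀ {A} → J ⊢ᶜ (⊥ᶜ ⇒ᶜ A)
    ⊤I  : J ⊢ᶜ ⊤ᶜ
    DNE : ∀ {A} → J ⊢ᶜ (¬ᶜ ¬ᶜ A ⇒ᶜ A)
    ∀E  : ∀ {A} y → J ⊢ᶜ (∀ᶜ A ⇒ᶜ renC (inst y) A)
    ∃I  : ∀ {A} y → J ⊢ᶜ (renC (inst y) A ⇒ᶜ ∃ᶜ A)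
    ∀Q  : ∀ {A B} → J ⊢ᶜ (∀ᶜ (wkC B ⇒ᶜ A) ⇒ᶜ B ⇒ᶜ ∀ᶜ A)
    ∃Q  : ∀ {A B} → J ⊢ᶜ (∀ᶜ (A ⇒ᶜ wkC B) ⇒ᶜ ∃ᶜ A ⇒ᶜ B)
    MP  : ∀ {A B} → J ⊢ᶜ (A ⇒ᶜ B) → J ⊢ᶜ A → J ⊢ᶜ B
    Gen : ∀ {A} → J ⊢ᶜ A → J ⊢ᶜ ∀ᶜ A
    ?∧  : ∀ {γ δ} → J ⊢ᶜ (¿ (γ ∧ⁱ δ) ⇔ᶜ (¿ γ ∧ᶜ ¿ δ))
    ?∨  : ∀ {γ δ} → J ⊢ᶜ (¿ (γ ∨ⁱ δ) ⇔ᶜ (¿ γ ∨ᶜ ¿ δ))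
    ?⇒  : ∀ {γ δ} → J ⊢ᶜ (¿ (γ ⇒ⁱ δ) ⇒ᶜ ¿ γ ⇒ᶜ ¿ δ)
    ?⋏  : J ⊢ᶜ (¬ᶜ (¿ ⋏))
    ?∃  : ∀ {θ} → J ⊢ᶜ (¿ (∃ⁱ θ) ⇔ᶜ ∃ᶜ (¿ θ))
    ?∀  : ∀ {θ} → J ⊢ᶜ (¿ (∀ⁱ θ) ⇒ᶜ ∀ᶜ (¿ θ))
    ?!  : ∀ {p} → J ⊢ᶜ (¿ (! p) ⇒ᶜ p)
    !-elim : ∀ {p} → J ⊢ⁱ (! p) → J ⊢ᶜ p

  data _⊢ⁱ_ (J : IForm → Set) : IForm → Set where
    K   : ∀ {A B} → J ⊢ⁱ (A ⇒ⁱ B ⇒ⁱ A)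
    S   : ∀ {A B C} → J ⊢ⁱ ((A ⇒ⁱ B ⇒ⁱ C) ⇒ⁱ (A ⇒ⁱ B) ⇒ⁱ A ⇒ⁱ C)
    ∧I  : ∀ {A B} → J ⊢ⁱ (A ⇒ⁱ B ⇒ⁱ A ∧ⁱ B)
    ∧E₁ : ∀ {A B} → J ⊢ⁱ (A ∧ⁱ B ⇒ⁱ A)
    ∧E₂ : ∀ {A B} → J ⊢ⁱ (A ∧ⁱ B ⇒ⁱ B)
    ∨I₁ : ∀ {A B} → J ⊢ⁱ (A ⇒ⁱ A ∨ⁱ B)
    ∨I₂ : ∀ {A B} → J ⊢ⁱ (B ⇒ⁱ A ∨ⁱ B)
    ∨E  : ∀ {A B C} → J ⊢ⁱ ((A ⇒ⁱ C) ⇒ⁱ (B ⇒ⁱ C) ⇒ⁱ A ∨ⁱ B ⇒ⁱ C)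
    ⋏E  : ∀ {A} → J ⊢ⁱ (⋏ ⇒ⁱ A)
    ✓I  : J ⊢ⁱ ✓
    ∀E  : ∀ {A} y → J ⊢ⁱ (∀ⁱ A ⇒ⁱ renI (inst y) A)
    ∃I  : ∀ {A} y → J ⊢ⁱ (renI (inst y) A ⇒ⁱ ∃ⁱ A)
    ∀Q  : ∀ {A B} → J ⊢ⁱ (∀ⁱ (wkI B ⇒ⁱ A) ⇒ⁱ B ⇒ⁱ ∀ⁱ A)
    ∃Q  : ∀ {A B} → J ⊢ⁱ (∀ⁱ (A ⇒ⁱ wkI B) ⇒ⁱ ∃ⁱ A ⇒ⁱ B)
    MP  : ∀ {A B} → J ⊢ⁱ (A ⇒ⁱ B) → J ⊢ⁱ A → J ⊢ⁱ B
    Gen : ∀ {A} → J ⊢ⁱ A → J ⊢ⁱ ∀ⁱ A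
    !?  : ∀ {γ} → J ⊢ⁱ (γ ⇒ⁱ ! (¿ γ))
    !⊥  : J ⊢ⁱ (¬ⁱ (! ⊥ᶜ))
    !?! : ∀ {p} → J ⊢ⁱ (! p ⇒ⁱ ! (¿ (! p)))
    !K  : ∀ {p q} → J ⊢ⁱ (! (p ⇒ᶜ q) ⇒ⁱ ! p ⇒ⁱ ! q)
    !-intro : ∀ {p} → J ⊢ᶜ p → J ⊢ⁱ (! p)
    ax  : ∀ {A} → J A → J ⊢ⁱ A

Jankov : IForm → Set
Jankov Φ = Σ[ ψ ∈ IForm ] (Φ ≡ (¬ⁱ ψ ∨ⁱ ¬ⁱ ¬ⁱ ψ))

ED : IForm → IForm → IForm
ED α β = ¬ⁱ (α ∧ⁱ β) ⇒ⁱ ∇ (α ∨ⁱ β) ⇒ⁱ ∇ α ∨ⁱ ∇ β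

-- By Jankov's principle, ¬α or ¬¬α. If ¬α, then ∇¬α (by γ → ∇γ), and since ?¬α refutes ?α
-- the classical disjunctive syllogism ?¬α, ?(α∨β) ⊢ ?β lifts through ! to ∇¬α, ∇(α∨β) ⊢ ∇β.
-- If ¬¬α, then ¬(α∧β) yields ¬β intuitionistically, and the symmetric argument gives ∇α.
module Submission where

open import Defs
open import Data.List using (List; []; _∷_)
open import Data.List.Membership.Propositional using (_∈_)
open import Data.List.Relation.Unary.Any using (here; there)
open import Data.Product using (_,_)
open import Relation.Binary.PropositionalEquality using (refl)

module Deduction
  {Form : Set} (_⇒_ : Form → Form → Form) (⊢_ : Form → Set)
  (K : ∀ {A B} → ⊢ (A ⇒ (B ⇒ A)))
  (S : ∀ {A B C} → ⊢ ((A ⇒ (B ⇒ C)) ⇒ ((A ⇒ B) ⇒ (A ⇒ C))))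
  (MP : ∀ {A B} → ⊢ (A ⇒ B) → ⊢ A → ⊢ B)
  where

  infixl 5 _·_
  infixr 4 ƛ_

  -- Hypotheses are only combined by modus ponens (no Gen), so K and S suffice for the deduction theorem ƛ_.
  data _⊩_ (Γ : List Form) : Form → Set where
    hyp : ∀ {A} → A ∈ Γ → Γ ⊩ A
    thm : ∀ {A} → ⊢ A → Γ ⊩ A
    _·_ : ∀ {A B} → Γ ⊩ (A ⇒ B) → Γ ⊩ A → Γ ⊩ B

  #0 : ∀ {Γ A} → (A ∷ Γ) ⊩ A
  #0 = hyp (here refl)

  #1 : ∀ {Γ A B} → (B ∷ A ∷ Γ) ⊩ A
  #1 = hyp (there (here refl))

  #2 : ∀ {Γ A B C} → (C ∷ B ∷ A ∷ Γ) ⊩ A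
  #2 = hyp (there (there (here refl)))

  #3 : ∀ {Γ A B C D} → (D ∷ C ∷ B ∷ A ∷ Γ) ⊩ A
  #3 = hyp (there (there (there (here refl))))

  ⊢-refl : ∀ {A} → ⊢ (A ⇒ A)
  ⊢-refl {A} = MP (MP S K) (K {B = A})

  ƛ_ : ∀ {Γ A B} → (A ∷ Γ) ⊩ B → Γ ⊩ (A ⇒ B)
  ƛ hyp (here refl) = thm ⊢-refl
  ƛ hyp (there A∈Γ) = thm K · hyp A∈Γ
  ƛ thm t           = thm K · thm t
  ƛ (f · a)         = thm S · (ƛ f) · (ƛ a)

  closed : ∀ {A} → [] ⊩ A → ⊢ A
  closed (hyp ())
  closed (thm t) = t
  closed (f · a) = MP (closed f) (closed a)

module _ {J : IForm → Set} where

  private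
    module C = Deduction _⇒ᶜ_ (J ⊢ᶜ_) K S MP
    module I = Deduction _⇒ⁱ_ (J ⊢ⁱ_) K S MP

  ?¬⇒¬? : ∀ {γ} → J ⊢ᶜ (¿ (¬ⁱ γ) ⇒ᶜ ¬ᶜ ¿ γ)
  ?¬⇒¬? = closed (ƛ ƛ thm ?⋏ · (thm ?⇒ · #1 · #0))
    where open C

  ?-syllogismˡ : ∀ {γ δ} → J ⊢ᶜ (¿ (¬ⁱ γ) ⇒ᶜ ¿ (γ ∨ⁱ δ) ⇒ᶜ ¿ δ)
  ?-syllogismˡ {γ} {δ} = closed (ƛ ƛ thm ∨E · refuted · thm ⊢-refl · (thm ∧E₁ · thm ?∨ · #0))
    where
    open C
    refuted : (¿ (γ ∨ⁱ δ) ∷ ¿ (¬ⁱ γ) ∷ []) ⊩ (¿ γ ⇒ᶜ ¿ δ)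
    refuted = ƛ thm ⊥E · (thm ?¬⇒¬? · #2 · #0)

  ?-syllogismʳ : ∀ {γ δ} → J ⊢ᶜ (¿ (¬ⁱ δ) ⇒ᶜ ¿ (γ ∨ⁱ δ) ⇒ᶜ ¿ γ)
  ?-syllogismʳ {γ} {δ} = closed (ƛ ƛ thm ∨E · thm ⊢-refl · refuted · (thm ∧E₁ · thm ?∨ · #0))
    where
    open C
    refuted : (¿ (γ ∨ⁱ δ) ∷ ¿ (¬ⁱ δ) ∷ []) ⊩ (¿ δ ⇒ᶜ ¿ γ)
    refuted = ƛ thm ⊥E · (thm ?¬⇒¬? · #2 · #0)

  !-map₂ : ∀ {a b c} → J ⊢ᶜ (a ⇒ᶜ b ⇒ᶜ c) → J ⊢ⁱ (! a ⇒ⁱ ! b ⇒ⁱ ! c)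
  !-map₂ a⇒b⇒c = closed (ƛ thm !K · (thm !K · thm (!-intro a⇒b⇒c) · #0))
    where open I

  ∇-syllogismˡ : ∀ {γ δ} → J ⊢ⁱ (¬ⁱ γ ⇒ⁱ ∇ (γ ∨ⁱ δ) ⇒ⁱ ∇ δ)
  ∇-syllogismˡ = closed (ƛ thm (!-map₂ ?-syllogismˡ) · (thm !? · #0))
    where open I

  ∇-syllogismʳ : ∀ {γ δ} → J ⊢ⁱ (¬ⁱ δ ⇒ⁱ ∇ (γ ∨ⁱ δ) ⇒ⁱ ∇ γ)
  ∇-syllogismʳ = closed (ƛ thm (!-map₂ ?-syllogismʳ) · (thm !? · #0))
    where open I

  ¬∧-¬¬⇒¬ : ∀ {γ δ} → J ⊢ⁱ (¬ⁱ (γ ∧ⁱ δ) ⇒ⁱ ¬ⁱ ¬ⁱ γ ⇒ⁱ ¬ⁱ δ)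
  ¬∧-¬¬⇒¬ = closed (ƛ ƛ ƛ #1 · (ƛ #3 · (thm ∧I · #0 · #1)))
    where open I

jankov : ∀ α → Jankov ⊢ⁱ (¬ⁱ α ∨ⁱ ¬ⁱ ¬ⁱ α)
jankov α = ax (α , refl)

mainTheorem19 : (α β : IForm) → Jankov ⊢ⁱ ED α β
mainTheorem19 α β = closed (ƛ ƛ thm ∨E · if¬α · if¬¬α · thm (jankov α))
  where
  open Deduction _⇒ⁱ_ (Jankov ⊢ⁱ_) K S MP

  Γ : List IForm
  Γ = ∇ (α ∨ⁱ β) ∷ ¬ⁱ (α ∧ⁱ β) ∷ []

  if¬α : Γ ⊩ (¬ⁱ α ⇒ⁱ ∇ α ∨ⁱ ∇ β)
  if¬α = ƛ thm ∨I₂ · (thm ∇-syllogismˡ · #0 · #1)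

  if¬¬α : Γ ⊩ (¬ⁱ ¬ⁱ α ⇒ⁱ ∇ α ∨ⁱ ∇ β)
  if¬¬α = ƛ thm ∨I₁ · (thm ∇-syllogismʳ · (thm ¬∧-¬¬⇒¬ · #2 · #0) · #1)
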